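{- Let $p,q,r$ be nonnegative integers and let $G=B(p,q,r)$, a graph of order $n=p+q+r+2$. Then the characteristic polynomial $\mu(G,x)=\det(xI-L(G))$ of the Laplacian matrix of $G$ satisfies $$\mu(G,x)=x(x-1)^{p+r-2}(x-2)^{q-1}(x^4-a_1x^3+a_2x^2-a_3x+a_4)$$ (as an identity of rational functions in $x$), where $a_1=2q+p+r+4$, $a_2=q^2+(p+r)q+pr+3(2q+p+r)+5$, $a_3=2(q^2+pq+rq+pr+3q+p+r+1)$, and $a_4=(p+q+r+2)q$.
   Context: The Laplacian matrix of a simple graph $G$ is $L(G)=D(G)-A(G)$, with $D(G)$ the diagonal degree matrix and $A(G)$ the adjacency matrix. The binary star graph $B(p,q,r)$ has vertex set $\{u,v,w_1,\dots,w_q,u_1,\dots,u_p,v_1,\dots,v_r\}$ and edge set consisting of $uw_i$ and $vw_i$ for $1\le i\le q$, $uu_j$ for $1\le j\le p$, and $vv_k$ for $1\le k\le r$ (so $u$ and $v$ are not adjacent; it is obtained from stars with centers $u$ and $v$ by identifying $q$ leaves of one with $q$ leaves of the other). -}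

module Defs where

open import Data.Nat as ℕ using (ℕ; zero; suc; _<ᵇ_; _≡ᵇ_)
open import Data.Integer using (ℤ; +_; _+_; _-_; _*_; -_; _^_)
open import Data.Fin using (Fin; zero; suc; toℕ; punchIn)
open import Data.Bool using (Bool; true; false; if_then_else_)

Matrix : ℕ → Set
Matrix n = Fin n → Fin n → ℤ

sumFin : (n : ℕ) → (Fin n → ℤ) → ℤ
sumFin zero    f = + 0
sumFin (suc n) f = f zero + sumFin n (λ i → f (suc i))

det : (n : ℕ) → Matrix n → ℤ
det zero    M = + 1
det (suc n) M =
  sumFin (suc n) (λ j →
    ((- + 1) ^ toℕ j) * M zero j * det n (λ a b → M (suc a) (punchIn j b)))

eqFin : {n : ℕ} → Fin n → Fin n → Bool
eqFin i j = toℕ i ≡ᵇ toℕ j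

degree : (n : ℕ) → Matrix n → Fin n → ℤ
degree n A i = sumFin n (λ j → A i j)

laplacian : (n : ℕ) → Matrix n → Matrix n
laplacian n A i j = (if eqFin i j then degree n A i else + 0) - A i j

charPolyAt : (n : ℕ) → Matrix n → ℤ → ℤ
charPolyAt n M x = det n (λ i j → (if eqFin i j then x else + 0) - M i j)

-- Binary star B(p,q,r) on vertices Fin (p+q+r+2), numbered
--   0 = u, 1 = v, 2..q+1 = w_1..w_q,
--   q+2..q+p+1 = u_1..u_p, q+p+2..q+p+r+1 = v_1..v_r
data Kind : Set where
  U V W UL VL : Kind

kindOf : (p q r : ℕ) → ℕ → Kind
kindOf p q r zero = U
kindOf p q r (suc zero) = V
kindOf p q r m =
  if m <ᵇ (2 ℕ.+ q) then W
  else if m <ᵇ (2 ℕ.+ q ℕ.+ p) then UL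
  else VL

adjKind : Kind → Kind → Bool
adjKind U W  = true
adjKind W U  = true
adjKind V W  = true
adjKind W V  = true
adjKind U UL = true
adjKind UL U = true
adjKind V VL = true
adjKind VL V = true
adjKind _ _  = false

order : (p q r : ℕ) → ℕ
order p q r = p ℕ.+ q ℕ.+ r ℕ.+ 2

binaryStarAdj : (p q r : ℕ) → Matrix (order p q r)
binaryStarAdj p q r i j =
  if adjKind (kindOf p q r (toℕ i)) (kindOf p q r (toℕ j)) then + 1 else + 0

mu : (p q r : ℕ) → ℤ → ℤ
mu p q r x = charPolyAt (order p q r) (laplacian (order p q r) (binaryStarAdj p q r)) x

{-# OPTIONS --safe #-}
module Submission where

-- Let M = xI − L(B(p,q,r)). Replacing the row of v by (x−1)·v − (x−1)·u + Σ_{UL} ℓ − Σ_{VL} ℓ,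
-- and then the row of u by (x−1)(x−2)·u − (x−1)·Σ_W w − (x−2)·Σ_{UL} ℓ, multiplies det M by
-- (x−1)²(x−2) and clears both rows outside the columns of u and v.  The vertices of kinds W, UL,
-- VL are pairwise non-adjacent, so what remains is block lower triangular: its lower block is
-- diagonal with product (x−2)^q (x−1)^(p+r), and the 2 × 2 block on {u, v} has determinant
-- x·(x⁴ − a₁x³ + a₂x² − a₃x + a₄), a polynomial identity in x, p, q, r.

open import Defs
open import Data.Nat using (ℕ; zero; suc; z≤n; s≤s; _<ᵇ_)
import Data.Nat as ℕ
open import Data.Nat.Properties using (≡ᵇ⇒≡; ≡⇒≡ᵇ; <⇒<ᵇ)
open import Data.Integer using (ℤ; +_; -[1+_]; -_; _+_; _-_; _*_; _^_)
import Data.Integer.Properties as ℤP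
open import Data.Fin using (Fin; zero; suc; toℕ; punchIn)
open import Data.Fin.Properties using (suc-injective; toℕ-injective; punchInᵢ≢i)
open import Data.Vec.Functional using (updateAt)
open import Data.Vec.Functional.Properties using (updateAt-updates; updateAt-minimal)
open import Data.Bool using (true; false; if_then_else_)
open import Data.Bool.Properties using (T-≡; ¬-not)
open import Data.List using (_∷_; [])
open import Data.Product using (_×_; _,_)
open import Function using (const; _∘_)
open import Function.Bundles using (Equivalence)
open import Relation.Binary.PropositionalEquality
open import Relation.Nullary using (contradiction)
open import Algebra.Bundles using (Monoid)
open import Algebra.Properties.Semiring.Sum ℤP.+-*-semiring
  using (sum; sum-syntax; sum-cong-≗; sum-replicate-zero; ∑-distrib-+; ∑-comm; sum-remove; *-distribˡ-sum)
open import Algebra.Properties.Monoid.Sum ℤP.*-1-monoid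
  using () renaming (sum to prod; sum-cong-≗ to prod-cong-≗)
open import Data.Integer.Tactic.RingSolver using (solve-∀; solve)
import Data.Nat.Tactic.RingSolver as ℕSolver

-- Finite sums and products

sumFin≡sum : ∀ n (f : Fin n → ℤ) → sumFin n f ≡ sum f
sumFin≡sum zero    f = refl
sumFin≡sum (suc n) f = cong (λ s → f zero + s) (sumFin≡sum n (f ∘ suc))

sum-zero : ∀ {n} {f : Fin n → ℤ} → (∀ i → f i ≡ + 0) → sum f ≡ + 0
sum-zero {n} f≗0 = trans (sum-cong-≗ f≗0) (sum-replicate-zero n)

sum-neg : ∀ {n} (f : Fin n → ℤ) → ∑[ i < n ] (- f i) ≡ - sum f
sum-neg f = begin
  ∑[ i < _ ] (- f i)       ≡⟨ sum-cong-≗ (λ i → sym (ℤP.-1*i≡-i (f i))) ⟩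
  ∑[ i < _ ] (- + 1 * f i) ≡⟨ *-distribˡ-sum (- + 1) f ⟨
  - + 1 * sum f            ≡⟨ ℤP.-1*i≡-i (sum f) ⟩
  - sum f                  ∎
  where open ≡-Reasoning

∑-linear : ∀ {n} (α β : ℤ) (f g : Fin n → ℤ) →
  ∑[ i < n ] (α * f i + β * g i) ≡ α * sum f + β * sum g
∑-linear α β f g =
  trans (∑-distrib-+ (λ i → α * f i) (λ i → β * g i))
        (sym (cong₂ _+_ (*-distribˡ-sum α f) (*-distribˡ-sum β g)))

sum-single : ∀ {n} (i : Fin n) (f : Fin n → ℤ) → (∀ j → j ≢ i → f j ≡ + 0) → sum f ≡ f i
sum-single {suc n} i f f≡0 = begin
  sum f                            ≡⟨ sum-remove {i = i} f ⟩
  f i + ∑[ t < n ] f (punchIn i t) ≡⟨ cong (λ s → f i + s) (sum-zero others≡0) ⟩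
  f i + + 0                        ≡⟨ ℤP.+-identityʳ (f i) ⟩
  f i                              ∎
  where
  open ≡-Reasoning
  others≡0 : ∀ t → f (punchIn i t) ≡ + 0
  others≡0 t = f≡0 (punchIn i t) (punchInᵢ≢i i t)

module IndexFold {c ℓ} (Mon : Monoid c ℓ) where
  open Monoid Mon using (Carrier; _≈_; _∙_; identityˡ; assoc; ∙-cong; ∙-congˡ)
    renaming (refl to ≈-refl; sym to ≈-sym; trans to ≈-trans)
  open import Algebra.Properties.Monoid.Sum Mon using () renaming (sum to fold)

  fold-toℕ-split : ∀ a b (f : ℕ → Carrier) →
    fold {a ℕ.+ b} (f ∘ toℕ) ≈ fold {a} (f ∘ toℕ) ∙ fold {b} (λ i → f (a ℕ.+ toℕ i))
  fold-toℕ-split zero    b f = ≈-sym (identityˡ _)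
  fold-toℕ-split (suc a) b f = ≈-trans (∙-congˡ (fold-toℕ-split a b (f ∘ suc))) (≈-sym (assoc _ _ _))

  fold-toℕ-cong : ∀ a {f g : ℕ → Carrier} → (∀ m → m ℕ.< a → f m ≈ g m) →
    fold {a} (f ∘ toℕ) ≈ fold {a} (g ∘ toℕ)
  fold-toℕ-cong zero    f≈g = ≈-refl
  fold-toℕ-cong (suc a) f≈g =
    ∙-cong (f≈g zero (s≤s z≤n)) (fold-toℕ-cong a (λ m m<a → f≈g (suc m) (s≤s m<a)))

  fold-blocks : ∀ a b c (f : ℕ → Carrier) {y₁ y₂ y₃ : Carrier} →
    (∀ m → m ℕ.< a → f m ≈ y₁) → (∀ m → m ℕ.< b → f (a ℕ.+ m) ≈ y₂) →
    (∀ m → f (a ℕ.+ (b ℕ.+ m)) ≈ y₃) →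
    fold {a ℕ.+ (b ℕ.+ c)} (f ∘ toℕ)
      ≈ fold {a} (const y₁) ∙ (fold {b} (const y₂) ∙ fold {c} (const y₃))
  fold-blocks a b c f f≈y₁ f≈y₂ f≈y₃ =
    ≈-trans (fold-toℕ-split a (b ℕ.+ c) f)
      (∙-cong (fold-toℕ-cong a f≈y₁)
        (≈-trans (fold-toℕ-split b c (λ m → f (a ℕ.+ m)))
          (∙-cong (fold-toℕ-cong b f≈y₂) (fold-toℕ-cong c (λ m _ → f≈y₃ m)))))

open IndexFold ℤP.+-0-monoid using () renaming (fold-blocks to sum-blocks)
open IndexFold ℤP.*-1-monoid using () renaming (fold-blocks to prod-blocks)

sum-const : ∀ n (c : ℤ) → ∑[ i < n ] c ≡ c * + n
sum-const zero    c = sym (ℤP.*-zeroʳ c)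
sum-const (suc n) c = begin
  c + ∑[ i < n ] c    ≡⟨ cong (λ s → c + s) (sum-const n c) ⟩
  c + c * + n         ≡⟨ collect c (+ n) ⟩
  c * (+ 1 + + n)     ≡⟨ cong (c *_) (ℤP.pos-+ 1 n) ⟨
  c * + suc n         ∎
  where
  open ≡-Reasoning
  collect : ∀ c m → c + c * m ≡ c * (+ 1 + m)
  collect = solve-∀

prod-const : ∀ n (c : ℤ) → prod {n} (λ _ → c) ≡ c ^ n
prod-const zero    c = refl
prod-const (suc n) c = cong (c *_) (prod-const n c)

eqFin-true⇒≡ : ∀ {n} {i j : Fin n} → eqFin i j ≡ true → i ≡ j
eqFin-true⇒≡ {i = i} {j} eq = toℕ-injective (≡ᵇ⇒≡ (toℕ i) (toℕ j) (Equivalence.from T-≡ eq))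

eqFin-refl : ∀ {n} (i : Fin n) → eqFin i i ≡ true
eqFin-refl i = Equivalence.to T-≡ (≡⇒≡ᵇ (toℕ i) (toℕ i) refl)

eqFin-≢ : ∀ {n} {i j : Fin n} → i ≢ j → eqFin i j ≡ false
eqFin-≢ i≢j = ¬-not (i≢j ∘ eqFin-true⇒≡)

<ᵇ-true : ∀ {m k} → m ℕ.< k → (m <ᵇ k) ≡ true
<ᵇ-true m<k = Equivalence.to T-≡ (<⇒<ᵇ m<k)

+-<ᵇ-false : ∀ k m → ((k ℕ.+ m) <ᵇ k) ≡ false
+-<ᵇ-false zero    m = refl
+-<ᵇ-false (suc k) m = +-<ᵇ-false k m

+-<ᵇ-+ : ∀ k m l → ((k ℕ.+ m) <ᵇ (k ℕ.+ l)) ≡ (m <ᵇ l)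
+-<ᵇ-+ zero    m l = refl
+-<ᵇ-+ (suc k) m l = +-<ᵇ-+ k m l

-- Determinants through the cofactor expansion

sign : ∀ {n} → Fin n → ℤ
sign j = (- + 1) ^ toℕ j

minor : ∀ {n} → Matrix (suc n) → Fin (suc n) → Matrix n
minor M j a b = M (suc a) (punchIn j b)

RowsAgreeExcept : ∀ {n} → Fin n → Matrix n → Matrix n → Set
RowsAgreeExcept i A B = ∀ k → k ≢ i → ∀ j → A k j ≡ B k j

cofactorTerm : ∀ n → Matrix (suc n) → Fin (suc n) → ℤ
cofactorTerm n M j = sign j * M zero j * det n (minor M j)

det-expand : ∀ n (M : Matrix (suc n)) → det (suc n) M ≡ sum (cofactorTerm n M)
det-expand n M = sumFin≡sum (suc n) (cofactorTerm n M)

det-cong : ∀ n {M N : Matrix n} → (∀ i j → M i j ≡ N i j) → det n M ≡ det n N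
det-cong zero    M≈N = refl
det-cong (suc n) {M} {N} M≈N = begin
  det (suc n) M           ≡⟨ det-expand n M ⟩
  sum (cofactorTerm n M)  ≡⟨ sum-cong-≗ term≈ ⟩
  sum (cofactorTerm n N)  ≡⟨ det-expand n N ⟨
  det (suc n) N           ∎
  where
  open ≡-Reasoning
  term≈ : ∀ j → cofactorTerm n M j ≡ cofactorTerm n N j
  term≈ j = cong₂ (λ m d → sign j * m * d) (M≈N zero j) (det-cong n (λ a b → M≈N (suc a) (punchIn j b)))

det-zero : ∀ n (M : Matrix (suc n)) → (∀ j → cofactorTerm n M j ≡ + 0) → det (suc n) M ≡ + 0
det-zero n M term≡0 = trans (det-expand n M) (sum-zero term≡0)

det-linear-terms : ∀ n {A B C : Matrix (suc n)} (α β : ℤ) →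
  (∀ j → cofactorTerm n A j ≡ α * cofactorTerm n B j + β * cofactorTerm n C j) →
  det (suc n) A ≡ α * det (suc n) B + β * det (suc n) C
det-linear-terms n {A} {B} {C} α β terms = begin
  det (suc n) A
    ≡⟨ det-expand n A ⟩
  sum (cofactorTerm n A)
    ≡⟨ sum-cong-≗ terms ⟩
  ∑[ j < suc n ] (α * cofactorTerm n B j + β * cofactorTerm n C j)
    ≡⟨ ∑-linear α β (cofactorTerm n B) (cofactorTerm n C) ⟩
  α * sum (cofactorTerm n B) + β * sum (cofactorTerm n C)
    ≡⟨ cong₂ (λ b c → α * b + β * c) (det-expand n B) (det-expand n C) ⟨
  α * det (suc n) B + β * det (suc n) C ∎
  where open ≡-Reasoning

det-linear-row : ∀ n (i : Fin n) {A B C : Matrix n} (α β : ℤ) →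
  RowsAgreeExcept i B A → RowsAgreeExcept i C A →
  (∀ j → A i j ≡ α * B i j + β * C i j) →
  det n A ≡ α * det n B + β * det n C
det-linear-row (suc n) zero {A} {B} {C} α β B≈A C≈A Aᵢ = det-linear-terms n {A} {B} {C} α β term
  where
  distrib : ∀ α β s b c d → s * (α * b + β * c) * d ≡ α * (s * b * d) + β * (s * c * d)
  distrib = solve-∀
  minor≈ : ∀ {X} → RowsAgreeExcept zero X A → ∀ j → det n (minor X j) ≡ det n (minor A j)
  minor≈ X≈A j = det-cong n (λ a b → X≈A (suc a) (λ ()) (punchIn j b))
  term : ∀ j → cofactorTerm n A j ≡ α * cofactorTerm n B j + β * cofactorTerm n C j
  term j rewrite minor≈ B≈A j | minor≈ C≈A j | Aᵢ j =
    distrib α β (sign j) (B zero j) (C zero j) (det n (minor A j))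
det-linear-row (suc n) (suc i) {A} {B} {C} α β B≈A C≈A Aᵢ = det-linear-terms n {A} {B} {C} α β term
  where
  distrib : ∀ α β s a b c → s * a * (α * b + β * c) ≡ α * (s * a * b) + β * (s * a * c)
  distrib = solve-∀
  term : ∀ j → cofactorTerm n A j ≡ α * cofactorTerm n B j + β * cofactorTerm n C j
  term j rewrite B≈A zero (λ ()) j | C≈A zero (λ ()) j
    | det-linear-row n i {minor A j} {minor B j} {minor C j} α β
        (λ k k≢i b → B≈A (suc k) (k≢i ∘ suc-injective) (punchIn j b))
        (λ k k≢i b → C≈A (suc k) (k≢i ∘ suc-injective) (punchIn j b))
        (λ b → Aᵢ (punchIn j b))
    = distrib α β (sign j) (A zero j) (det n (minor B j)) (det n (minor C j))

-- For j ≢ c, punchIn₂ j c enumerates the columns other than j and c in increasing order.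
punchIn₂ : ∀ {n} → Fin (suc (suc n)) → Fin (suc (suc n)) → Fin n → Fin (suc (suc n))
punchIn₂ zero    zero    b = suc (suc b)
punchIn₂ zero    (suc c) b = suc (punchIn c b)
punchIn₂ (suc j) zero    b = suc (punchIn j b)
punchIn₂ {suc n} (suc j) (suc c) zero    = zero
punchIn₂ {suc n} (suc j) (suc c) (suc b) = suc (punchIn₂ j c b)

punchIn₂-punchIn : ∀ {n} (j : Fin (suc (suc n))) k b → punchIn₂ j (punchIn j k) b ≡ punchIn j (punchIn k b)
punchIn₂-punchIn zero    k       b       = refl
punchIn₂-punchIn (suc j) zero    b       = refl
punchIn₂-punchIn {suc n} (suc j) (suc k) zero    = refl
punchIn₂-punchIn {suc n} (suc j) (suc k) (suc b) = cong suc (punchIn₂-punchIn j k b)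

punchIn₂-comm : ∀ {n} (j c : Fin (suc (suc n))) b → punchIn₂ j c b ≡ punchIn₂ c j b
punchIn₂-comm zero    zero    b = refl
punchIn₂-comm zero    (suc c) b = refl
punchIn₂-comm (suc j) zero    b = refl
punchIn₂-comm {suc n} (suc j) (suc c) zero    = refl
punchIn₂-comm {suc n} (suc j) (suc c) (suc b) = cong suc (punchIn₂-comm j c b)

-- The sign of column c in the expansion of minor M j along its first row (0 when c = j).
sign₂ : ∀ {n} → Fin (suc n) → Fin (suc n) → ℤ
sign₂ zero    zero    = + 0
sign₂ zero    (suc c) = sign c
sign₂ (suc j) zero    = + 1
sign₂ {suc n} (suc j) (suc c) = - sign₂ j c

sign₂-diag : ∀ {n} (j : Fin (suc n)) → sign₂ j j ≡ + 0
sign₂-diag zero            = refl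
sign₂-diag {suc n} (suc j) = cong -_ (sign₂-diag j)

sign₂-punchIn : ∀ {n} (j : Fin (suc n)) k → sign₂ j (punchIn j k) ≡ sign k
sign₂-punchIn zero            k       = refl
sign₂-punchIn (suc j)         zero    = refl
sign₂-punchIn {suc n} (suc j) (suc k) =
  trans (cong -_ (sign₂-punchIn j k)) (sym (ℤP.-1*i≡-i (sign k)))

sign₂-antisym : ∀ {n} (j c : Fin (suc n)) → sign j * sign₂ j c ≡ - (sign c * sign₂ c j)
sign₂-antisym zero            zero    = refl
sign₂-antisym zero            (suc c) = flip₁ (sign c)
  where flip₁ : ∀ s → + 1 * s ≡ - (- + 1 * s * + 1)
        flip₁ = solve-∀
sign₂-antisym (suc j)         zero    = flip₂ (sign j)
  where flip₂ : ∀ s → - + 1 * s * + 1 ≡ - (+ 1 * s)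
        flip₂ = solve-∀
sign₂-antisym {suc n} (suc j) (suc c) =
  trans (negate (sign j) (sign₂ j c)) (trans (sign₂-antisym j c) (cong -_ (sym (negate (sign c) (sign₂ c j)))))
  where negate : ∀ s t → - + 1 * s * - t ≡ s * t
        negate = solve-∀

doubleTerm : ∀ n → Matrix (suc (suc n)) → Fin (suc (suc n)) → Fin (suc (suc n)) → ℤ
doubleTerm n M j c =
  sign j * sign₂ j c * M zero j * M (suc zero) c * det n (λ a b → M (suc (suc a)) (punchIn₂ j c b))

det-expand₂ : ∀ n (M : Matrix (suc (suc n))) →
  det (suc (suc n)) M ≡ ∑[ j < suc (suc n) ] ∑[ c < suc (suc n) ] doubleTerm n M j c
det-expand₂ n M = trans (det-expand (suc n) M) (sum-cong-≗ cofactor≡)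
  where
  open ≡-Reasoning
  reorder : ∀ s m t u e → s * m * (t * u * e) ≡ s * t * m * u * e
  reorder = solve-∀
  kill : ∀ s m u e → s * + 0 * m * u * e ≡ + 0
  kill = solve-∀
  cofactor≡ : ∀ j → cofactorTerm (suc n) M j ≡ ∑[ c < suc (suc n) ] doubleTerm n M j c
  cofactor≡ j = begin
    sign j * M zero j * det (suc n) (minor M j)
      ≡⟨ cong (sign j * M zero j *_) (det-expand n (minor M j)) ⟩
    sign j * M zero j * sum (cofactorTerm n (minor M j))
      ≡⟨ *-distribˡ-sum (sign j * M zero j) (cofactorTerm n (minor M j)) ⟩
    ∑[ k < suc n ] (sign j * M zero j * cofactorTerm n (minor M j) k)
      ≡⟨ sum-cong-≗ cofactor-punchIn ⟩
    ∑[ k < suc n ] doubleTerm n M j (punchIn j k)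
      ≡⟨ ℤP.+-identityˡ _ ⟨
    + 0 + ∑[ k < suc n ] doubleTerm n M j (punchIn j k)
      ≡⟨ cong (_+ ∑[ k < suc n ] doubleTerm n M j (punchIn j k)) diag≡0 ⟨
    doubleTerm n M j j + ∑[ k < suc n ] doubleTerm n M j (punchIn j k)
      ≡⟨ sum-remove (doubleTerm n M j) ⟨
    ∑[ c < suc (suc n) ] doubleTerm n M j c ∎
    where
    diag≡0 : doubleTerm n M j j ≡ + 0
    diag≡0 rewrite sign₂-diag j = kill (sign j) (M zero j) (M (suc zero) j) _
    cofactor-punchIn : ∀ k → sign j * M zero j * cofactorTerm n (minor M j) k ≡ doubleTerm n M j (punchIn j k)
    cofactor-punchIn k rewrite sign₂-punchIn j k =
      trans (cong (λ e → sign j * M zero j * (sign k * M (suc zero) (punchIn j k) * e))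
                  (det-cong n (λ a b → cong (M (suc (suc a))) (sym (punchIn₂-punchIn j k b)))))
            (reorder (sign j) (M zero j) (sign k) (M (suc zero) (punchIn j k)) _)

swap₀₁ : ∀ {n} {A : Set} → (Fin (suc (suc n)) → A) → Fin (suc (suc n)) → A
swap₀₁ f zero          = f (suc zero)
swap₀₁ f (suc zero)    = f zero
swap₀₁ f (suc (suc i)) = f (suc (suc i))

-- The swap exchanges the double-expansion terms of the column pairs (j, c) and (c, j) up to sign.
det-swap₀₁ : ∀ n (M : Matrix (suc (suc n))) → det (suc (suc n)) (swap₀₁ M) ≡ - det (suc (suc n)) M
det-swap₀₁ n M = begin
  det N (swap₀₁ M)                                  ≡⟨ det-expand₂ n (swap₀₁ M) ⟩
  ∑[ j < N ] ∑[ c < N ] doubleTerm n (swap₀₁ M) j c ≡⟨ sum-cong-≗ (λ j → sum-cong-≗ (antisym j)) ⟩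
  ∑[ j < N ] ∑[ c < N ] (- doubleTerm n M c j)      ≡⟨ sum-cong-≗ (λ j → sum-neg (λ c → doubleTerm n M c j)) ⟩
  ∑[ j < N ] (- ∑[ c < N ] doubleTerm n M c j)      ≡⟨ sum-neg (λ j → ∑[ c < N ] doubleTerm n M c j) ⟩
  - (∑[ j < N ] ∑[ c < N ] doubleTerm n M c j)      ≡⟨ cong -_ (∑-comm (λ j c → doubleTerm n M c j)) ⟩
  - (∑[ c < N ] ∑[ j < N ] doubleTerm n M c j)      ≡⟨ cong -_ (det-expand₂ n M) ⟨
  - det N M                                         ∎
  where
  open ≡-Reasoning
  N : ℕ
  N = suc (suc n)
  swap-rows : ∀ s t a b e → - (s * t) * a * b * e ≡ - (s * t * b * a * e)
  swap-rows = solve-∀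
  antisym : ∀ j c → doubleTerm n (swap₀₁ M) j c ≡ - doubleTerm n M c j
  antisym j c rewrite sign₂-antisym j c
    | det-cong n (λ a b → cong (M (suc (suc a))) (punchIn₂-comm j c b)) =
    swap-rows (sign c) (sign₂ c j) (M (suc zero) j) (M zero c) _

≡-neg⇒≡0 : ∀ (a : ℤ) → a ≡ - a → a ≡ + 0
≡-neg⇒≡0 (+ zero)  _  = refl
≡-neg⇒≡0 (+ suc n) ()
≡-neg⇒≡0 -[1+ n ]  ()

cofactorTerm-entry-zero : ∀ n (M : Matrix (suc n)) j → M zero j ≡ + 0 → cofactorTerm n M j ≡ + 0
cofactorTerm-entry-zero n M j M₀ⱼ≡0 rewrite M₀ⱼ≡0 | ℤP.*-zeroʳ (sign j) = refl

cofactorTerm-minor-zero : ∀ n (M : Matrix (suc n)) j → det n (minor M j) ≡ + 0 → cofactorTerm n M j ≡ + 0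
cofactorTerm-minor-zero n M j minor≡0 rewrite minor≡0 = ℤP.*-zeroʳ (sign j * M zero j)

-- Rows 0 and 1 equal: det M = − det M by the swap.  Rows 0 and k + 2 equal: after the swap,
-- every minor along the first row has two equal rows.
det-equal-rows₀ : ∀ n (M : Matrix (suc n)) k → (∀ j → M zero j ≡ M (suc k) j) → det (suc n) M ≡ + 0
det-equal-rows₀ (suc n) M zero rows≡ = ≡-neg⇒≡0 _ (trans (det-cong (suc (suc n)) M≈swap) (det-swap₀₁ n M))
  where
  M≈swap : ∀ i j → M i j ≡ swap₀₁ M i j
  M≈swap zero          j = rows≡ j
  M≈swap (suc zero)    j = sym (rows≡ j)
  M≈swap (suc (suc i)) j = refl
det-equal-rows₀ (suc n) M (suc k) rows≡ = begin
  det (suc (suc n)) M               ≡⟨ ℤP.neg-involutive _ ⟨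
  - - det (suc (suc n)) M           ≡⟨ cong -_ (det-swap₀₁ n M) ⟨
  - det (suc (suc n)) (swap₀₁ M)    ≡⟨ cong -_ (det-zero (suc n) (swap₀₁ M) swapped-minor-zero) ⟩
  + 0                               ∎
  where
  open ≡-Reasoning
  swapped-minor-zero : ∀ j → cofactorTerm (suc n) (swap₀₁ M) j ≡ + 0
  swapped-minor-zero j = cofactorTerm-minor-zero (suc n) (swap₀₁ M) j
    (det-equal-rows₀ n (minor (swap₀₁ M) j) k (rows≡ ∘ punchIn j))

det-equal-rows : ∀ n (M : Matrix n) {i k : Fin n} → i ≢ k → (∀ j → M i j ≡ M k j) → det n M ≡ + 0
det-equal-rows (suc n) M {zero}  {zero}  i≢k _     = contradiction refl i≢k
det-equal-rows (suc n) M {zero}  {suc k} _   rows≡ = det-equal-rows₀ n M k rows≡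
det-equal-rows (suc n) M {suc i} {zero}  _   rows≡ = det-equal-rows₀ n M i (sym ∘ rows≡)
det-equal-rows (suc n) M {suc i} {suc k} i≢k rows≡ = det-zero n M (λ j →
  cofactorTerm-minor-zero n M j (det-equal-rows n (minor M j) (i≢k ∘ cong suc) (rows≡ ∘ punchIn j)))

replaceRow : ∀ {n} → Matrix n → Fin n → (Fin n → ℤ) → Matrix n
replaceRow M i R = updateAt M i (const R)

replaceRow-row : ∀ {n} (M : Matrix n) i R j → replaceRow M i R i j ≡ R j
replaceRow-row M i R j = cong-app (updateAt-updates i M) j

replaceRow-agrees : ∀ {n} (M : Matrix n) i R → RowsAgreeExcept i (replaceRow M i R) M
replaceRow-agrees M i R k k≢i j = cong-app (updateAt-minimal k i M k≢i) j

-- Induction on the number of added rows: by linearity in row i, the first added row splits off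
-- as a matrix with two equal rows.
det-add-row-family : ∀ n (i : Fin n) (c : ℤ) m (g : Fin m → Fin n) (d : Fin m → ℤ) {M A : Matrix n} →
  (∀ t → g t ≢ i) → RowsAgreeExcept i A M →
  (∀ j → A i j ≡ c * M i j + ∑[ t < m ] (d t * M (g t) j)) →
  det n A ≡ c * det n M
det-add-row-family n i c zero g d {M} {A} _ A≈M Aᵢ =
  trans (det-linear-row n i c (+ 0) M≈A M≈A Aᵢ) (ℤP.+-identityʳ (c * det n M))
  where
  M≈A : RowsAgreeExcept i M A
  M≈A k k≢i j = sym (A≈M k k≢i j)
det-add-row-family n i c (suc m) g d {M} {A} g≢i A≈M Aᵢ = begin
  det n A                                 ≡⟨ det-linear-row n i (+ 1) (d zero) A′≈A B≈A A-split ⟩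
  + 1 * det n A′ + d zero * det n B       ≡⟨ cong₂ (λ a b → + 1 * a + d zero * b) det-A′ det-B ⟩
  + 1 * (c * det n M) + d zero * + 0      ≡⟨ simplify (c * det n M) (d zero) ⟩
  c * det n M                             ∎
  where
  open ≡-Reasoning
  rest : Fin n → ℤ
  rest j = ∑[ t < m ] (d (suc t) * M (g (suc t)) j)
  A′ B : Matrix n
  A′ = replaceRow M i (λ j → c * M i j + rest j)
  B  = replaceRow M i (M (g zero))
  A′≈A : RowsAgreeExcept i A′ A
  A′≈A k k≢i j = trans (replaceRow-agrees M i _ k k≢i j) (sym (A≈M k k≢i j))
  B≈A : RowsAgreeExcept i B A
  B≈A k k≢i j = trans (replaceRow-agrees M i _ k k≢i j) (sym (A≈M k k≢i j))
  regroup : ∀ a b u v → a + (u * b + v) ≡ + 1 * (a + v) + u * b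
  regroup = solve-∀
  A-split : ∀ j → A i j ≡ + 1 * A′ i j + d zero * B i j
  A-split j rewrite replaceRow-row M i (λ j → c * M i j + rest j) j | replaceRow-row M i (M (g zero)) j =
    trans (Aᵢ j) (regroup (c * M i j) (M (g zero) j) (d zero) (rest j))
  det-A′ : det n A′ ≡ c * det n M
  det-A′ = det-add-row-family n i c m (g ∘ suc) (d ∘ suc) (g≢i ∘ suc) (replaceRow-agrees M i _)
    (replaceRow-row M i (λ j → c * M i j + rest j))
  det-B : det n B ≡ + 0
  det-B = det-equal-rows n B (λ i≡g → g≢i zero (sym i≡g))
    (λ j → trans (replaceRow-row M i _ j) (sym (replaceRow-agrees M i _ (g zero) (g≢i zero) j)))
  simplify : ∀ a u → + 1 * a + u * + 0 ≡ a
  simplify = solve-∀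

det-add-rows : ∀ n (i : Fin n) (c : ℤ) (d : Fin n → ℤ) {M A : Matrix n} → d i ≡ + 0 →
  RowsAgreeExcept i A M → (∀ j → A i j ≡ c * M i j + ∑[ k < n ] (d k * M k j)) →
  det n A ≡ c * det n M
det-add-rows (suc n) i c d {M} {A} dᵢ≡0 A≈M Aᵢ =
  det-add-row-family (suc n) i c n (punchIn i) (d ∘ punchIn i) (punchInᵢ≢i i) A≈M Aᵢ′
  where
  drop-i : ∀ j → ∑[ k < suc n ] (d k * M k j) ≡ ∑[ t < n ] (d (punchIn i t) * M (punchIn i t) j)
  drop-i j rewrite sum-remove {i = i} (λ k → d k * M k j) | dᵢ≡0 = ℤP.+-identityˡ _
  Aᵢ′ : ∀ j → A i j ≡ c * M i j + ∑[ t < n ] (d (punchIn i t) * M (punchIn i t) j)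
  Aᵢ′ j = trans (Aᵢ j) (cong (λ s → c * M i j + s) (drop-i j))

det-firstRow-zero : ∀ n (M : Matrix (suc n)) → (∀ j → M zero (suc j) ≡ + 0) →
  det (suc n) M ≡ M zero zero * det n (λ a b → M (suc a) (suc b))
det-firstRow-zero n M row≡0 = begin
  det (suc n) M                                               ≡⟨ det-expand n M ⟩
  cofactorTerm n M zero + ∑[ j < n ] cofactorTerm n M (suc j) ≡⟨ cong (λ s → cofactorTerm n M zero + s) rest≡0 ⟩
  cofactorTerm n M zero + + 0                                 ≡⟨ ℤP.+-identityʳ _ ⟩
  + 1 * M zero zero * D                                       ≡⟨ cong (_* D) (ℤP.*-identityˡ (M zero zero)) ⟩
  M zero zero * D                                             ∎
  where
  open ≡-Reasoning
  D : ℤ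
  D = det n (λ a b → M (suc a) (suc b))
  rest≡0 : ∑[ j < n ] cofactorTerm n M (suc j) ≡ + 0
  rest≡0 = sum-zero (λ j → cofactorTerm-entry-zero n M (suc j) (row≡0 j))

det-diagonal : ∀ n (M : Matrix n) → (∀ a b → a ≢ b → M a b ≡ + 0) → det n M ≡ prod (λ i → M i i)
det-diagonal zero    M _        = refl
det-diagonal (suc n) M offDiag≡0 =
  trans (det-firstRow-zero n M (λ j → offDiag≡0 zero (suc j) (λ ())))
        (cong (M zero zero *_) (det-diagonal n (λ a b → M (suc a) (suc b))
                                 (λ a b a≢b → offDiag≡0 (suc a) (suc b) (a≢b ∘ suc-injective))))

det-block₂ : ∀ n (M : Matrix (suc (suc n))) →
  (∀ j → M zero (suc (suc j)) ≡ + 0) → (∀ j → M (suc zero) (suc (suc j)) ≡ + 0) →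
  (∀ a b → a ≢ b → M (suc (suc a)) (suc (suc b)) ≡ + 0) →
  det (suc (suc n)) M ≡
    (M zero zero * M (suc zero) (suc zero) - M zero (suc zero) * M (suc zero) zero)
      * prod (λ i → M (suc (suc i)) (suc (suc i)))
det-block₂ n M row₀≡0 row₁≡0 offDiag≡0 = begin
  det (suc (suc n)) M
    ≡⟨ det-expand (suc n) M ⟩
  cofactorTerm (suc n) M zero + (cofactorTerm (suc n) M (suc zero) + rest)
    ≡⟨ cong₂ (λ d₀ d₁ → + 1 * M zero zero * d₀ + (- + 1 * + 1 * M zero (suc zero) * d₁ + rest))
             (det-firstRow-zero n (minor M zero) row₁≡0) (det-firstRow-zero n (minor M (suc zero)) row₁≡0) ⟩
  + 1 * a * (d * det n D) + (- + 1 * + 1 * b * (c * det n D) + rest)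
    ≡⟨ cong₂ (λ δ ρ → + 1 * a * (d * δ) + (- + 1 * + 1 * b * (c * δ) + ρ))
             (det-diagonal n D offDiag≡0) rest≡0 ⟩
  + 1 * a * (d * P) + (- + 1 * + 1 * b * (c * P) + + 0)
    ≡⟨ expand-2×2 a b c d P ⟩
  (a * d - b * c) * P ∎
  where
  open ≡-Reasoning
  a b c d P : ℤ
  a = M zero zero
  b = M zero (suc zero)
  c = M (suc zero) zero
  d = M (suc zero) (suc zero)
  D : Matrix n
  D i j = M (suc (suc i)) (suc (suc j))
  P = prod (λ i → D i i)
  rest : ℤ
  rest = ∑[ j < n ] cofactorTerm (suc n) M (suc (suc j))
  rest≡0 : rest ≡ + 0
  rest≡0 = sum-zero (λ j → cofactorTerm-entry-zero (suc n) M (suc (suc j)) (row₀≡0 j))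
  expand-2×2 : ∀ a b c d P → + 1 * a * (d * P) + (- + 1 * + 1 * b * (c * P) + + 0) ≡ (a * d - b * c) * P
  expand-2×2 = solve-∀

-- The computation on vertex kinds

OnLeaves : (Kind → Set) → Set
OnLeaves P = P W × P UL × P VL

module QuotientAlgebra (x Q P R : ℤ) where

  adj : Kind → Kind → ℤ
  adj κ κ′ = if adjKind κ κ′ then + 1 else + 0

  deg : Kind → ℤ
  deg U  = Q + P
  deg V  = Q + R
  deg W  = + 2
  deg UL = + 1
  deg VL = + 1

  leafCount : (Kind → ℤ) → ℤ
  leafCount g = g W * Q + (g UL * P + g VL * R)

  adj-irreflexive : ∀ κ → adj κ κ ≡ + 0
  adj-irreflexive U  = refl
  adj-irreflexive V  = refl
  adj-irreflexive W  = refl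
  adj-irreflexive UL = refl
  adj-irreflexive VL = refl

  deg-count : ∀ κ → adj κ U + (adj κ V + leafCount (adj κ)) ≡ deg κ
  deg-count U  = counted
    where counted : adj U U + (adj U V + (adj U W * Q + (adj U UL * P + adj U VL * R))) ≡ Q + P
          counted = solve (Q ∷ P ∷ R ∷ [])
  deg-count V  = counted
    where counted : adj V U + (adj V V + (adj V W * Q + (adj V UL * P + adj V VL * R))) ≡ Q + R
          counted = solve (Q ∷ P ∷ R ∷ [])
  deg-count W  = refl
  deg-count UL = refl
  deg-count VL = refl

  centreEntry : Kind → Kind → ℤ
  centreEntry U U  = x - deg U
  centreEntry V V  = x - deg V
  centreEntry κ κ′ = adj κ κ′

  -- A row operation replaces a pivot row by scale·(pivot row) + onU·(row of u)
  -- + Σ onLeaf(kind ℓ)·(row of ℓ), the sum running over the vertices ℓ of kinds W, UL, VL.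
  record RowOperation : Set where
    field
      scale onU : ℤ
      onLeaf    : Kind → ℤ
  open RowOperation public

  atLeaf : RowOperation → Kind → Kind → ℤ
  atLeaf op pivot κ = scale op * adj pivot κ + (onU op * adj U κ + onLeaf op κ * (x - deg κ))

  atCentre : RowOperation → Kind → Kind → ℤ
  atCentre op pivot κ =
    scale op * centreEntry pivot κ + (onU op * centreEntry U κ + leafCount (λ κ′ → onLeaf op κ′ * adj κ′ κ))

  vOnLeaf : Kind → ℤ
  vOnLeaf UL = + 1
  vOnLeaf VL = - + 1
  vOnLeaf _  = + 0

  uOnLeaf : Kind → ℤ
  uOnLeaf W  = - (x - + 1)
  uOnLeaf UL = - (x - + 2)
  uOnLeaf _  = + 0

  vOperation uOperation : RowOperation
  vOperation = record { scale = x - + 1 ; onU = - (x - + 1) ; onLeaf = vOnLeaf }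
  uOperation = record { scale = (x - + 1) * (x - + 2) ; onU = + 0 ; onLeaf = uOnLeaf }

  vOperation-clears-leaves : OnLeaves (λ κ → atLeaf vOperation V κ ≡ + 0)
  vOperation-clears-leaves = atW , atUL , atVL
    where
    atW  : (x - + 1) * adj V W  + (- (x - + 1) * adj U W  + + 0   * (x - deg W))  ≡ + 0
    atW  = solve (x ∷ [])
    atUL : (x - + 1) * adj V UL + (- (x - + 1) * adj U UL + + 1   * (x - deg UL)) ≡ + 0
    atUL = solve (x ∷ [])
    atVL : (x - + 1) * adj V VL + (- (x - + 1) * adj U VL + - + 1 * (x - deg VL)) ≡ + 0
    atVL = solve (x ∷ [])

  uOperation-clears-leaves : OnLeaves (λ κ → atLeaf uOperation U κ ≡ + 0)
  uOperation-clears-leaves = atW , atUL , atVL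
    where
    atW  : (x - + 1) * (x - + 2) * adj U W  + (+ 0 * adj U W  + - (x - + 1) * (x - deg W))  ≡ + 0
    atW  = solve (x ∷ [])
    atUL : (x - + 1) * (x - + 2) * adj U UL + (+ 0 * adj U UL + - (x - + 2) * (x - deg UL)) ≡ + 0
    atUL = solve (x ∷ [])
    atVL : (x - + 1) * (x - + 2) * adj U VL + (+ 0 * adj U VL + + 0 * (x - deg VL))         ≡ + 0
    atVL = solve (x ∷ [])

  quartic : ℤ
  quartic = x ^ 4
    - (+ 2 * Q + P + R + + 4) * x ^ 3
    + (Q * Q + (P + R) * Q + P * R + + 3 * (+ 2 * Q + P + R) + + 5) * x ^ 2
    - + 2 * (Q * Q + P * Q + R * Q + P * R + + 3 * Q + P + R + + 1) * x
    + (P + Q + R + + 2) * Q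

  quotient-det :
    atCentre uOperation U U * atCentre vOperation V V - atCentre uOperation U V * atCentre vOperation V U
      ≡ x * quartic
  quotient-det = expanded
    where
    -- The entries with the definitions unfolded and powers written as the iterated products
    -- _^_ reduces to: the ring solver cannot read Data.Integer's _^_.
    expanded :
      let dᵤ = Q + P
          dᵥ = Q + R
          uᵤ = (x - + 1) * (x - + 2) * (x - dᵤ)
                 + (+ 0 * (x - dᵤ) + (- (x - + 1) * adj W U * Q + (- (x - + 2) * adj UL U * P + + 0 * adj VL U * R)))
          uᵥ = (x - + 1) * (x - + 2) * adj U V
                 + (+ 0 * adj U V + (- (x - + 1) * adj W V * Q + (- (x - + 2) * adj UL V * P + + 0 * adj VL V * R)))
          vᵤ = (x - + 1) * adj V U
                 + (- (x - + 1) * (x - dᵤ) + (+ 0 * adj W U * Q + (+ 1 * adj UL U * P + - + 1 * adj VL U * R)))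
          vᵥ = (x - + 1) * (x - dᵥ)
                 + (- (x - + 1) * adj U V + (+ 0 * adj W V * Q + (+ 1 * adj UL V * P + - + 1 * adj VL V * R)))
          x² = x * (x * + 1)
          x³ = x * x²
      in uᵤ * vᵥ - uᵥ * vᵤ
         ≡ x * (x * x³ - (+ 2 * Q + P + R + + 4) * x³
                + (Q * Q + (P + R) * Q + P * R + + 3 * (+ 2 * Q + P + R) + + 5) * x²
                - + 2 * (Q * Q + P * Q + R * Q + P * R + + 3 * Q + P + R + + 1) * x
                + (P + Q + R + + 2) * Q)
    expanded = solve (x ∷ Q ∷ P ∷ R ∷ [])

-- The binary star

module BinaryStar (p q r : ℕ) (x : ℤ) where
  open QuotientAlgebra x (+ q) (+ p) (+ r) public

  N n : ℕ
  N = q ℕ.+ (p ℕ.+ r)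
  n = suc (suc N)

  adjacency : (k : ℕ) → Matrix k
  adjacency k i j = adj (kindOf p q r (toℕ i)) (kindOf p q r (toℕ j))

  charMatrix : (k : ℕ) → Matrix k
  charMatrix k i j = (if eqFin i j then x else + 0) - laplacian k (adjacency k) i j

  M : Matrix n
  M = charMatrix n

  kind : Fin n → Kind
  kind i = kindOf p q r (toℕ i)

  -- kind (suc (suc t)) reduces to leafKind (toℕ t).
  leafKind : ℕ → Kind
  leafKind m = if m <ᵇ q then W else if m <ᵇ q ℕ.+ p then UL else VL

  leafKind-elim : ∀ {P : Kind → Set} → OnLeaves P → ∀ m → P (leafKind m)
  leafKind-elim (w , ul , vl) m with m <ᵇ q | m <ᵇ q ℕ.+ p
  ... | true  | _     = w
  ... | false | true  = ul
  ... | false | false = vl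

  leafKind-W : ∀ {m} → m ℕ.< q → leafKind m ≡ W
  leafKind-W m<q rewrite <ᵇ-true m<q = refl

  leafKind-UL : ∀ {m} → m ℕ.< p → leafKind (q ℕ.+ m) ≡ UL
  leafKind-UL {m} m<p rewrite +-<ᵇ-false q m | +-<ᵇ-+ q m p | <ᵇ-true m<p = refl

  leafKind-VL : ∀ m → leafKind (q ℕ.+ (p ℕ.+ m)) ≡ VL
  leafKind-VL m rewrite +-<ᵇ-false q (p ℕ.+ m) | +-<ᵇ-+ q (p ℕ.+ m) p | +-<ᵇ-false p m = refl

  count-leaves : ∀ g → ∑[ t < N ] g (leafKind (toℕ t)) ≡ leafCount g
  count-leaves g =
    trans (sum-blocks q p r (g ∘ leafKind) (λ _ m<q → cong g (leafKind-W m<q))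
                                           (λ _ m<p → cong g (leafKind-UL m<p)) (cong g ∘ leafKind-VL))
          (cong₂ _+_ (sum-const q (g W)) (cong₂ _+_ (sum-const p (g UL)) (sum-const r (g VL))))

  prod-leaves : ∀ g → prod {N} (λ t → g (leafKind (toℕ t))) ≡ g W ^ q * (g UL ^ p * g VL ^ r)
  prod-leaves g =
    trans (prod-blocks q p r (g ∘ leafKind) (λ _ m<q → cong g (leafKind-W m<q))
                                            (λ _ m<p → cong g (leafKind-UL m<p)) (cong g ∘ leafKind-VL))
          (cong₂ _*_ (prod-const q (g W)) (cong₂ _*_ (prod-const p (g UL)) (prod-const r (g VL))))

  degree-kind : ∀ i → degree n (adjacency n) i ≡ deg (kind i)
  degree-kind i = begin
    degree n (adjacency n) i
      ≡⟨ sumFin≡sum n (adjacency n i) ⟩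
    adj κ U + (adj κ V + ∑[ t < N ] adj κ (leafKind (toℕ t)))
      ≡⟨ cong (λ s → adj κ U + (adj κ V + s)) (count-leaves (adj κ)) ⟩
    adj κ U + (adj κ V + leafCount (adj κ))
      ≡⟨ deg-count κ ⟩
    deg κ ∎
    where
    open ≡-Reasoning
    κ : Kind
    κ = kind i

  charMatrix-entry : ∀ i j →
    M i j ≡ (if eqFin i j then x - (degree n (adjacency n) i - adj (kind i) (kind j)) else adj (kind i) (kind j))
  charMatrix-entry i j = subtract (eqFin i j) (degree n (adjacency n) i) (adj (kind i) (kind j))
    where
    cancel : ∀ a → + 0 - (+ 0 - a) ≡ a
    cancel = solve-∀
    subtract : ∀ b d a → (if b then x else + 0) - ((if b then d else + 0) - a) ≡ (if b then x - (d - a) else a)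
    subtract true  d a = refl
    subtract false d a = cancel a

  charMatrix-diagonal : ∀ i → M i i ≡ x - deg (kind i)
  charMatrix-diagonal i rewrite charMatrix-entry i i | eqFin-refl i | degree-kind i | adj-irreflexive (kind i) =
    cong (λ d → x - d) (ℤP.+-identityʳ (deg (kind i)))

  charMatrix-offDiagonal : ∀ i j → i ≢ j → M i j ≡ adj (kind i) (kind j)
  charMatrix-offDiagonal i j i≢j rewrite charMatrix-entry i j | eqFin-≢ i≢j = refl

  leaves-nonadjacent : ∀ m m′ → adj (leafKind m) (leafKind m′) ≡ + 0
  leaves-nonadjacent m m′ =
    leafKind-elim {λ κ → adj κ (leafKind m′) ≡ + 0}
      ( leafKind-elim {λ κ′ → adj W  κ′ ≡ + 0} (refl , refl , refl) m′
      , leafKind-elim {λ κ′ → adj UL κ′ ≡ + 0} (refl , refl , refl) m′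
      , leafKind-elim {λ κ′ → adj VL κ′ ≡ + 0} (refl , refl , refl) m′ ) m

  leaves-offDiagonal : ∀ a b → a ≢ b → M (suc (suc a)) (suc (suc b)) ≡ + 0
  leaves-offDiagonal a b a≢b =
    trans (charMatrix-offDiagonal (suc (suc a)) (suc (suc b)) (a≢b ∘ suc-injective ∘ suc-injective))
          (leaves-nonadjacent (toℕ a) (toℕ b))

  leafRows : (Kind → ℤ) → Fin n → ℤ
  leafRows e j = ∑[ t < N ] (e (leafKind (toℕ t)) * M (suc (suc t)) j)

  combinedRow : RowOperation → Fin n → Fin n → ℤ
  combinedRow op i j = scale op * M i j + (onU op * M zero j + leafRows (onLeaf op) j)

  coefficients : RowOperation → Fin n → ℤ
  coefficients op zero          = onU op
  coefficients op (suc zero)    = + 0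
  coefficients op (suc (suc t)) = onLeaf op (leafKind (toℕ t))

  combinedRow-sum : ∀ op i j → combinedRow op i j ≡ scale op * M i j + ∑[ k < n ] (coefficients op k * M k j)
  combinedRow-sum op i j = cong (λ s → scale op * M i j + (onU op * M zero j + s)) (sym (ℤP.+-identityˡ _))

  leafRows-leafColumn : ∀ e m → leafRows e (suc (suc m)) ≡ e (leafKind (toℕ m)) * (x - deg (leafKind (toℕ m)))
  leafRows-leafColumn e m =
    trans (sum-single m _ other≡0) (cong (e (leafKind (toℕ m)) *_) (charMatrix-diagonal (suc (suc m))))
    where
    other≡0 : ∀ t → t ≢ m → e (leafKind (toℕ t)) * M (suc (suc t)) (suc (suc m)) ≡ + 0
    other≡0 t t≢m =
      trans (cong (e (leafKind (toℕ t)) *_) (leaves-offDiagonal t m t≢m)) (ℤP.*-zeroʳ (e (leafKind (toℕ t))))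

  leafRows-centreColumn : ∀ e j → (∀ t → suc (suc t) ≢ j) →
    leafRows e j ≡ leafCount (λ κ → e κ * adj κ (kind j))
  leafRows-centreColumn e j leaf≢j =
    trans (sum-cong-≗ (λ t → cong (e (leafKind (toℕ t)) *_)
                                  (charMatrix-offDiagonal (suc (suc t)) j (leaf≢j t))))
          (count-leaves (λ κ → e κ * adj κ (kind j)))

  combinedRow-leafColumn : ∀ op i m → i ≢ suc (suc m) →
    combinedRow op i (suc (suc m)) ≡ atLeaf op (kind i) (leafKind (toℕ m))
  combinedRow-leafColumn op i m i≢leaf =
    cong₂ (λ a s → scale op * a + s) (charMatrix-offDiagonal i (suc (suc m)) i≢leaf)
      (cong₂ (λ a s → onU op * a + s) (charMatrix-offDiagonal zero (suc (suc m)) (λ ()))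
        (leafRows-leafColumn (onLeaf op) m))

  centre : Fin 2 → Fin n
  centre zero       = zero
  centre (suc zero) = suc zero

  centre-entry : ∀ a b → M (centre a) (centre b) ≡ centreEntry (kind (centre a)) (kind (centre b))
  centre-entry zero       zero       = charMatrix-diagonal zero
  centre-entry zero       (suc zero) = charMatrix-offDiagonal zero (suc zero) (λ ())
  centre-entry (suc zero) zero       = charMatrix-offDiagonal (suc zero) zero (λ ())
  centre-entry (suc zero) (suc zero) = charMatrix-diagonal (suc zero)

  centre-notLeaf : ∀ b t → suc (suc t) ≢ centre b
  centre-notLeaf zero       t ()
  centre-notLeaf (suc zero) t ()

  combinedRow-centreColumn : ∀ op a b →
    combinedRow op (centre a) (centre b) ≡ atCentre op (kind (centre a)) (kind (centre b))
  combinedRow-centreColumn op a b =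
    cong₂ (λ e s → scale op * e + s) (centre-entry a b)
      (cong₂ (λ e s → onU op * e + s) (centre-entry zero b)
        (leafRows-centreColumn (onLeaf op) (centre b) (centre-notLeaf b)))

  M₁ M₂ : Matrix n
  M₁ = replaceRow M (suc zero) (combinedRow vOperation (suc zero))
  M₂ = replaceRow M₁ zero (combinedRow uOperation zero)

  det-M₂ : det n M₂ ≡ scale uOperation * (scale vOperation * det n M)
  det-M₂ =
    trans (det-add-rows n zero (scale uOperation) (coefficients uOperation) refl
                        (replaceRow-agrees M₁ zero (combinedRow uOperation zero)) (combinedRow-sum uOperation zero))
          (cong (scale uOperation *_)
            (det-add-rows n (suc zero) (scale vOperation) (coefficients vOperation) refl
                          (replaceRow-agrees M (suc zero) (combinedRow vOperation (suc zero)))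
                          (λ j → trans (replaceRow-row M (suc zero) (combinedRow vOperation (suc zero)) j)
                                       (combinedRow-sum vOperation (suc zero) j))))

  M₂-row₀ : ∀ m → M₂ zero (suc (suc m)) ≡ + 0
  M₂-row₀ m = trans (combinedRow-leafColumn uOperation zero m (λ ()))
                    (leafKind-elim {λ κ → atLeaf uOperation U κ ≡ + 0} uOperation-clears-leaves (toℕ m))

  M₂-row₁ : ∀ m → M₂ (suc zero) (suc (suc m)) ≡ + 0
  M₂-row₁ m = trans (combinedRow-leafColumn vOperation (suc zero) m (λ ()))
                    (leafKind-elim {λ κ → atLeaf vOperation V κ ≡ + 0} vOperation-clears-leaves (toℕ m))

  M₂-diagonal : prod (λ t → M₂ (suc (suc t)) (suc (suc t))) ≡ (x - + 2) ^ q * ((x - + 1) ^ p * (x - + 1) ^ r)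
  M₂-diagonal = trans (prod-cong-≗ (λ t → charMatrix-diagonal (suc (suc t)))) (prod-leaves (λ κ → x - deg κ))

  M₂-centre :
    M₂ zero zero * M₂ (suc zero) (suc zero) - M₂ zero (suc zero) * M₂ (suc zero) zero ≡ x * quartic
  M₂-centre = trans (cong₂ (λ a b → a - b)
                      (cong₂ _*_ (combinedRow-centreColumn uOperation zero zero)
                                 (combinedRow-centreColumn vOperation (suc zero) (suc zero)))
                      (cong₂ _*_ (combinedRow-centreColumn uOperation zero (suc zero))
                                 (combinedRow-centreColumn vOperation (suc zero) zero)))
                    quotient-det

  det-charMatrix : det n M * (x - + 1) ^ 2 * (x - + 2) ≡ x * (x - + 1) ^ (p ℕ.+ r) * (x - + 2) ^ q * quartic
  det-charMatrix = begin
    det n M * (x - + 1) ^ 2 * (x - + 2)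
      ≡⟨ pivots (det n M) ⟩
    scale uOperation * (scale vOperation * det n M)
      ≡⟨ det-M₂ ⟨
    det n M₂
      ≡⟨ det-block₂ N M₂ M₂-row₀ M₂-row₁ leaves-offDiagonal ⟩
    (M₂ zero zero * M₂ (suc zero) (suc zero) - M₂ zero (suc zero) * M₂ (suc zero) zero)
      * prod (λ t → M₂ (suc (suc t)) (suc (suc t)))
      ≡⟨ cong₂ _*_ M₂-centre M₂-diagonal ⟩
    x * quartic * ((x - + 2) ^ q * ((x - + 1) ^ p * (x - + 1) ^ r))
      ≡⟨ rearrange quartic ((x - + 2) ^ q) ((x - + 1) ^ p) ((x - + 1) ^ r) ⟩
    x * ((x - + 1) ^ p * (x - + 1) ^ r) * (x - + 2) ^ q * quartic
      ≡⟨ cong (λ t → x * t * (x - + 2) ^ q * quartic) (ℤP.^-distribˡ-+-* (x - + 1) p r) ⟨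
    x * (x - + 1) ^ (p ℕ.+ r) * (x - + 2) ^ q * quartic ∎
    where
    open ≡-Reasoning
    -- (x − 1) ^ 2 unfolded, as in quotient-det.
    pivots : ∀ D → D * ((x - + 1) * ((x - + 1) * + 1)) * (x - + 2) ≡ (x - + 1) * (x - + 2) * ((x - + 1) * D)
    pivots D = solve (D ∷ x ∷ [])
    rearrange : ∀ f a b c → x * f * (a * (b * c)) ≡ x * (b * c) * a * f
    rearrange f a b c = solve (x ∷ f ∷ a ∷ b ∷ c ∷ [])

mainTheorem3 : (p q r : ℕ) → (x : ℤ) →
    mu p q r x * (x - + 1) ^ 2 * (x - + 2)
      ≡ x * (x - + 1) ^ (Data.Nat._+_ p r) * (x - + 2) ^ q
        * (x ^ 4
           - (+ 2 * + q + + p + + r + + 4) * x ^ 3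
           + (+ q * + q + (+ p + + r) * + q + + p * + r + + 3 * (+ 2 * + q + + p + + r) + + 5) * x ^ 2
           - + 2 * (+ q * + q + + p * + q + + r * + q + + p * + r + + 3 * + q + + p + + r + + 1) * x
           + (+ p + + q + + r + + 2) * + q)
mainTheorem3 p q r x = at (order p q r) (order≡ p q r)
  where
  open BinaryStar p q r x
  order≡ : ∀ p q r → p ℕ.+ q ℕ.+ r ℕ.+ 2 ≡ 2 ℕ.+ (q ℕ.+ (p ℕ.+ r))
  order≡ = ℕSolver.solve-∀
  -- order p q r is only propositionally 2 + N, hence the matrix is defined at every size.
  at : ∀ k → k ≡ n →
    det k (charMatrix k) * (x - + 1) ^ 2 * (x - + 2) ≡ x * (x - + 1) ^ (p ℕ.+ r) * (x - + 2) ^ q * quartic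
  at _ refl = det-charMatrix
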